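{- Let $\Delta\ge 2$ be an integer. Let $G$ be a finite graph of maximum degree less than $\Delta$ and $L$ a list assignment of $G$ (on vertices and edges) in which every list has size at least $6\Delta$. Then for every vertex or edge $x$ of $G$, $$|C_L(G)|\ge 3\Delta\,|C_L(G\setminus\{x\})|.$$
   Context: A sequence $s_1\ldots s_{2k}$ ($k\ge1$) is a square if $s_i=s_{i+k}$ for all $i$; it is non-repetitive if it has no consecutive subsequence that is a square. Elements of a graph are its vertices and edges. A mixed-path of $G$ is an alternating sequence of vertices and edges in which consecutive elements are incident in $G$, with no element repeated. For a set $S$ of elements of $G$, $G\setminus S$ denotes the structure obtained by deleting exactly the elements of $S$ (an edge is not deleted when one of its endpoints is deleted, so edges may lack endpoints); the mixed-paths of $G\setminus S$ are the mixed-paths of $G$ all of whose elements lie outside $S$. A coloring of the elements of $G\setminus S$ is a weak total Thue coloring if the color sequence of every mixed-path of $G\setminus S$ is non-repetitive. $L$ assigns to each element a set of colors, and $C_L(G\setminus S)$ is the set of weak total Thue colorings of $G\setminus S$ in which every element $y$ receives a color from $L(y)$ (the empty structure has exactly one coloring). -}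

module Defs where

open import Data.Nat using (ℕ; _<_)
open import Data.Fin using (Fin)
open import Data.Fin.Properties using () renaming (_≟_ to _≟ᶠ_)
open import Data.Product using (Σ; ∃; _×_; _,_; proj₁; proj₂)
open import Data.Sum using (_⊎_; inj₁; inj₂)
open import Data.Empty using (⊥)
open import Data.Maybe using (Maybe; just; nothing)
open import Data.List using (List; []; _++_; map; length; filter; allFin)
open import Data.List.Membership.Propositional using (_∈_)
open import Data.List.Relation.Unary.All using (All)
open import Data.List.Relation.Unary.Linked using (Linked)
open import Data.List.Relation.Unary.Unique.Propositional using (Unique)
open import Data.Vec using (Vec; lookup)
open import Relation.Nullary using (¬_; Dec)
open import Relation.Nullary.Decidable using (_⊎-dec_)
open import Relation.Binary.PropositionalEquality using (_≡_; _≢_)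
open import Function.Bundles using (_⇔_)

record Graph : Set where
  field
    n     : ℕ
    m     : ℕ
    ends  : Fin m → Fin n × Fin n
    loopless : ∀ e → proj₁ (ends e) ≢ proj₂ (ends e)
    simple   : ∀ e f →
               (proj₁ (ends e) ≡ proj₁ (ends f) × proj₂ (ends e) ≡ proj₂ (ends f)) ⊎
               (proj₁ (ends e) ≡ proj₂ (ends f) × proj₂ (ends e) ≡ proj₁ (ends f)) →
               e ≡ f

open Graph public

Elem : Graph → Set
Elem G = Fin (n G) ⊎ Fin (m G)

EndOf : (G : Graph) → Fin (n G) → Fin (m G) → Set
EndOf G v e = (v ≡ proj₁ (ends G e)) ⊎ (v ≡ proj₂ (ends G e))

endOf? : (G : Graph) → ∀ v e → Dec (EndOf G v e)
endOf? G v e = (v ≟ᶠ proj₁ (ends G e)) ⊎-dec (v ≟ᶠ proj₂ (ends G e))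

degree : (G : Graph) → Fin (n G) → ℕ
degree G v = length (filter (endOf? G v) (allFin (m G)))

Inc : (G : Graph) → Elem G → Elem G → Set
Inc G (inj₁ v) (inj₂ e) = EndOf G v e
Inc G (inj₂ e) (inj₁ v) = EndOf G v e
Inc G _        _        = ⊥

Square : {A : Set} → List A → Set
Square {A} s = Σ (List A) λ w → (w ≢ []) × (s ≡ w ++ w)

NonRepetitive : {A : Set} → List A → Set
NonRepetitive {A} s = ∀ (a w b : List A) → s ≡ a ++ w ++ b → ¬ Square w

-- Deleted sets S are predicates on elements.
-- Mixed-paths of G ∖ S: sequences of elements, consecutive ones incident
-- (hence alternating vertex/edge), no repetition, avoiding S.

MixedPath : (G : Graph) → (S : Elem G → Set) → List (Elem G) → Set
MixedPath G S p = Linked (Inc G) p × Unique p × All (λ y → ¬ S y) p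

-- A (partial) coloring: a colour (just c) or nothing for each element.
-- Convention: deleted elements carry `nothing`, the others `just c`.
Coloring : Graph → Set
Coloring G = Vec (Maybe ℕ) (n G) × Vec (Maybe ℕ) (m G)

colAt : (G : Graph) → Coloring G → Elem G → Maybe ℕ
colAt G (cv , ce) (inj₁ v) = lookup cv v
colAt G (cv , ce) (inj₂ e) = lookup ce e

-- c ∈ C_L(G ∖ S): list colouring of the elements outside S which is a
-- weak total Thue colouring of G ∖ S.
InCL : (G : Graph) → (L : Elem G → List ℕ) → (S : Elem G → Set) → Coloring G → Set
InCL G L S c =
  (∀ y → S y → colAt G c y ≡ nothing) ×
  (∀ y → ¬ S y → ∃ λ k → (colAt G c y ≡ just k) × (k ∈ L y)) ×
  (∀ p → MixedPath G S p → NonRepetitive (map (colAt G c) p))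

HasSize : {A : Set} → (A → Set) → ℕ → Set
HasSize {A} P k =
  Σ (List A) λ xs → Unique xs × (∀ a → (a ∈ xs) ⇔ P a) × (length xs ≡ k)

NoElems : (G : Graph) → Elem G → Set
NoElems G _ = ⊥

module Submission where

-- Deleting elements one at a time, it suffices to show 3Δ·|C(G ∖ (D ∪ {x}))| ≤ |C(G ∖ D)| for every deleted set
-- D and x ∉ D, by induction on the number of elements left. Extend each colouring of G ∖ (D ∪ {x}) by each of the
-- at least 6Δ colours of x. An extension that is not a colouring of G ∖ D has a square h t on a mixed path of
-- G ∖ D, which must pass through x; reversing the path if necessary, x lies in h. Such an extension is determined
-- by the path h t and by the same colouring with h deleted, since h repeats the colours of t. If h has k + 1
-- elements, there are at most (k + 1)Δ^(k+1) such paths (non-backtracking walks from x in both directions), and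
-- by induction at most |C(G ∖ (D ∪ {x}))| / (3Δ)^k colourings with h deleted. As Σ (k + 1)/3^k = 9/4 ≤ 3, at most
-- 3Δ·|C(G ∖ (D ∪ {x}))| extensions are bad, so 6Δ·|C(G ∖ (D ∪ {x}))| ≤ |C(G ∖ D)| + 3Δ·|C(G ∖ (D ∪ {x}))|.

open import Defs
open import Data.Bool using (Bool; true; false; if_then_else_)
open import Data.Nat using (ℕ; zero; suc; _+_; _*_; _^_; _∸_; _⊓_; _≤_; _<_; z≤n; s≤s)
open import Data.Nat.Properties
open import Data.Nat.ListAction using (sum)
open import Data.Nat.Tactic.RingSolver using (solve-∀)
open import Data.Fin using (Fin; zero; suc)
open import Data.Fin.Properties using () renaming (_≟_ to _≟ᶠ_)
open import Data.Maybe using (Maybe; just; nothing)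
open import Data.Maybe.Properties using (just-injective) renaming (≡-dec to ≡-decᴹ)
open import Data.Vec using (Vec; []; _∷_; lookup; tabulate)
import Data.Vec.Properties as Vec
open import Data.List
  using (List; []; _∷_; _++_; map; length; filter; concatMap; reverse; reverseAcc; take; allFin; downFrom;
         cartesianProduct; cartesianProductWith)
open import Data.List.Properties
open import Data.List.Membership.Propositional using (_∈_; _∉_)
open import Data.List.Membership.Propositional.Properties
open import Data.List.Relation.Unary.Any as Any using (here; there; _─_)
import Data.List.Relation.Unary.Any.Properties as AnyP
open import Data.List.Relation.Unary.All as All using (All; []; _∷_; all?)
import Data.List.Relation.Unary.All.Properties as All
open import Data.List.Relation.Unary.AllPairs using ([]; _∷_)
open import Data.List.Relation.Unary.Linked as Linked using (Linked; []; [-]; _∷_; linked?)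
open import Data.List.Relation.Unary.Unique.Propositional using (Unique)
import Data.List.Relation.Unary.Unique.Propositional.Properties as Unique
open import Data.Product using (Σ; ∃; _×_; _,_; proj₁; proj₂)
open import Data.Product.Properties using (,-injective)
open import Data.Sum using (_⊎_; inj₁; inj₂; [_,_]′)
open import Data.Sum.Properties using (inj₁-injective; inj₂-injective) renaming (≡-dec to ≡-dec⊎)
open import Data.Empty using (⊥-elim)
open import Function using (flip; _∘_)
open import Function.Bundles using (Equivalence)
open import Relation.Nullary using (¬_; ¬?; Dec; yes; no; does)
open import Relation.Nullary.Decidable using (_×-dec_)
open import Relation.Unary using (Pred; Decidable)
open import Relation.Binary.Definitions using (DecidableEquality)
open import Level using (0ℓ)
open import Relation.Binary.PropositionalEquality

module _ {A : Set} where

  ∈-─⁺ : ∀ {z w : A} {ys} (p : z ∈ ys) → w ∈ ys → w ≢ z → w ∈ (ys ─ p)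
  ∈-─⁺ (here refl) (here refl) w≢z = ⊥-elim (w≢z refl)
  ∈-─⁺ (here refl) (there q)   _   = q
  ∈-─⁺ (there p)   (here refl) _   = here refl
  ∈-─⁺ (there p)   (there q)   w≢z = there (∈-─⁺ p q w≢z)

  Unique-⊆⇒length≤ : ∀ {xs ys : List A} → Unique xs → (∀ {z} → z ∈ xs → z ∈ ys) → length xs ≤ length ys
  Unique-⊆⇒length≤ {[]}     _            _  = z≤n
  Unique-⊆⇒length≤ {x ∷ xs} {ys} (x∉ ∷ u) xs⊆ys =
    subst (suc (length xs) ≤_) (sym (length-removeAt′ ys _))
      (s≤s (Unique-⊆⇒length≤ u λ z∈ → ∈-─⁺ (xs⊆ys (here refl)) (xs⊆ys (there z∈)) λ { refl → All.lookup x∉ z∈ refl }))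

  Unique-⇔⇒length≡ : ∀ {xs ys : List A} → Unique xs → Unique ys →
                     (∀ {z} → z ∈ xs → z ∈ ys) → (∀ {z} → z ∈ ys → z ∈ xs) → length xs ≡ length ys
  Unique-⇔⇒length≡ u v xs⊆ys ys⊆xs = ≤-antisym (Unique-⊆⇒length≤ u xs⊆ys) (Unique-⊆⇒length≤ v ys⊆xs)

  Unique-++⁻ˡ : ∀ (xs : List A) {ys} → Unique (xs ++ ys) → Unique xs
  Unique-++⁻ˡ []       _        = []
  Unique-++⁻ˡ (x ∷ xs) (x∉ ∷ u) = All.++⁻ˡ xs x∉ ∷ Unique-++⁻ˡ xs u

  Unique-++⁻ʳ : ∀ (xs : List A) {ys} → Unique (xs ++ ys) → Unique ys
  Unique-++⁻ʳ []       u       = u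
  Unique-++⁻ʳ (x ∷ xs) (_ ∷ u) = Unique-++⁻ʳ xs u

  Unique-++⇒disjoint : ∀ (xs : List A) {ys z} → Unique (xs ++ ys) → z ∈ xs → z ∉ ys
  Unique-++⇒disjoint (x ∷ xs) (x∉ ∷ _) (here refl) z∈ys = All.lookup (All.++⁻ʳ xs x∉) z∈ys refl
  Unique-++⇒disjoint (x ∷ xs) (_ ∷ u)  (there z∈)  = Unique-++⇒disjoint xs u z∈

  Unique-reverse⁺ : ∀ {xs : List A} → Unique xs → Unique (reverse xs)
  Unique-reverse⁺ {[]}     []       = []
  Unique-reverse⁺ {x ∷ xs} (x∉ ∷ u) =
    subst Unique (sym (unfold-reverse x xs))
      (snoc (Unique-reverse⁺ u) (λ p → All.lookup x∉ (AnyP.reverse⁻ p) refl))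
    where
    snoc : ∀ {ys} → Unique ys → x ∉ ys → Unique (ys ++ x ∷ [])
    snoc {[]}     []        _  = [] ∷ []
    snoc {y ∷ ys} (y∉ ∷ u′) x∉ = All.++⁺ y∉ ((λ { refl → x∉ (here refl) }) ∷ []) ∷ snoc u′ (x∉ ∘ there)

  Linked-++⁻ˡ : ∀ {R : A → A → Set} xs {ys} → Linked R (xs ++ ys) → Linked R xs
  Linked-++⁻ˡ []           _       = []
  Linked-++⁻ˡ (x ∷ [])     _       = [-]
  Linked-++⁻ˡ (x ∷ y ∷ xs) (r ∷ l) = r ∷ Linked-++⁻ˡ (y ∷ xs) l

  Linked-++⁻ʳ : ∀ {R : A → A → Set} xs {ys} → Linked R (xs ++ ys) → Linked R ys
  Linked-++⁻ʳ []           l       = l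
  Linked-++⁻ʳ (x ∷ [])     l       = Linked.tail l
  Linked-++⁻ʳ (x ∷ y ∷ xs) (_ ∷ l) = Linked-++⁻ʳ (y ∷ xs) l

  Linked-reverse⁺ : ∀ {R : A → A → Set} {xs} → Linked R xs → Linked (flip R) (reverse xs)
  Linked-reverse⁺ {xs = []}     _ = []
  Linked-reverse⁺ {xs = x ∷ xs} l = go [-] l
    where
    go : ∀ {R : A → A → Set} {acc x xs} → Linked (flip R) (x ∷ acc) → Linked R (x ∷ xs) →
         Linked (flip R) (reverseAcc (x ∷ acc) xs)
    go acc [-]     = acc
    go acc (r ∷ l) = go (r ∷ acc) l

  ++-cancel-length : ∀ (xs ys us vs : List A) → xs ++ ys ≡ us ++ vs → length xs ≡ length us →
                     xs ≡ us × ys ≡ vs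
  ++-cancel-length []       ys []       vs eq _ = refl , eq
  ++-cancel-length (x ∷ xs) ys (u ∷ us) vs eq l with refl , eq′ ← ∷-injective eq
    with refl , refl ← ++-cancel-length xs ys us vs eq′ (suc-injective l) = refl , refl

  agree-on-copy : ∀ {B : Set} (f g : A → B) {h t} → map f h ≡ map f t → map g h ≡ map g t →
                  (∀ {w} → w ∈ t → f w ≡ g w) → ∀ {z} → z ∈ h → f z ≡ g z
  agree-on-copy f g {a ∷ h} {b ∷ t} eqf eqg f≗g (here refl) =
    trans (∷-injectiveˡ eqf) (trans (f≗g (here refl)) (sym (∷-injectiveˡ eqg)))
  agree-on-copy f g {a ∷ h} {b ∷ t} eqf eqg f≗g (there z∈) =
    agree-on-copy f g (∷-injectiveʳ eqf) (∷-injectiveʳ eqg) (λ w∈ → f≗g (there w∈)) z∈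

  length-filter-mono : ∀ {P Q : Pred A 0ℓ} (P? : Decidable P) (Q? : Decidable Q) → (∀ {z} → P z → Q z) → ∀ xs →
                       length (filter P? xs) ≤ length (filter Q? xs)
  length-filter-mono P? Q? P⊆Q []       = z≤n
  length-filter-mono P? Q? P⊆Q (z ∷ xs) with P? z | Q? z
  ... | yes p | yes _ = s≤s (length-filter-mono P? Q? P⊆Q xs)
  ... | yes p | no ¬q = ⊥-elim (¬q (P⊆Q p))
  ... | no _  | yes _ = m≤n⇒m≤1+n (length-filter-mono P? Q? P⊆Q xs)
  ... | no _  | no _  = length-filter-mono P? Q? P⊆Q xs

  length-filter-strict : ∀ {P Q : Pred A 0ℓ} (P? : Decidable P) (Q? : Decidable Q) → (∀ {z} → P z → Q z) →
                         ∀ {xs y} → y ∈ xs → Q y → ¬ P y →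
                         length (filter P? xs) < length (filter Q? xs)
  length-filter-strict P? Q? P⊆Q {z ∷ xs} (here refl) qy ¬py with P? z | Q? z
  ... | yes p | _     = ⊥-elim (¬py p)
  ... | no _  | yes _ = s≤s (length-filter-mono P? Q? P⊆Q xs)
  ... | no _  | no ¬q = ⊥-elim (¬q qy)
  length-filter-strict P? Q? P⊆Q {z ∷ xs} (there y∈) qy ¬py with P? z | Q? z
  ... | yes p | yes _ = s≤s (length-filter-strict P? Q? P⊆Q y∈ qy ¬py)
  ... | yes p | no ¬q = ⊥-elim (¬q (P⊆Q p))
  ... | no _  | yes _ = m≤n⇒m≤1+n (length-filter-strict P? Q? P⊆Q y∈ qy ¬py)
  ... | no _  | no _  = length-filter-strict P? Q? P⊆Q y∈ qy ¬py

  listsUpTo : List A → ℕ → List (List A)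
  listsUpTo xs zero    = [] ∷ []
  listsUpTo xs (suc k) = [] ∷ concatMap (λ y → map (y ∷_) (listsUpTo xs k)) xs

  ∈-listsUpTo : ∀ {xs} → (∀ z → z ∈ xs) → ∀ k p → length p ≤ k → p ∈ listsUpTo xs k
  ∈-listsUpTo all∈ zero    []      _         = here refl
  ∈-listsUpTo all∈ (suc k) []      _         = here refl
  ∈-listsUpTo all∈ (suc k) (y ∷ p) (s≤s p≤k) =
    there (∈-concatMap⁺ (λ y → map (y ∷_) (listsUpTo _ k))
                        (Any.map (λ { refl → ∈-map⁺ (y ∷_) (∈-listsUpTo all∈ k p p≤k) }) (all∈ y)))

  ∈-take⇒split : ∀ {x : A} k q → x ∈ take k q →
                 Σ (List A) λ pre → Σ (List A) λ r → q ≡ pre ++ x ∷ r × length pre < k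
  ∈-take⇒split (suc k) (y ∷ q) (here refl) = [] , q , refl , s≤s z≤n
  ∈-take⇒split (suc k) (y ∷ q) (there x∈) with pre , r , refl , pre<k ← ∈-take⇒split k q x∈ =
    y ∷ pre , r , refl , s≤s pre<k

  length-filter-≢ : (_≟_ : DecidableEquality A) → ∀ {x h} → Unique h → x ∈ h →
                    suc (length (filter (λ z → ¬? (z ≟ x)) h)) ≡ length h
  length-filter-≢ _≟_ {x} {y ∷ h} (y∉ ∷ u) x∈ with y ≟ x
  ... | yes refl = cong (suc ∘ length) (filter-all (λ z → ¬? (z ≟ x)) (All.map (λ x≢z z≡x → x≢z (sym z≡x)) y∉))
  length-filter-≢ _≟_ (_ ∷ _) (here refl) | no y≢x = ⊥-elim (y≢x refl)
  length-filter-≢ _≟_ (_ ∷ u) (there x∈)  | no _   = cong suc (length-filter-≢ _≟_ u x∈)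

  take-length-++ : ∀ (h t : List A) → take (length h) (h ++ t) ≡ h
  take-length-++ []      t = refl
  take-length-++ (z ∷ h) t = cong (z ∷_) (take-length-++ h t)

module _ {A B : Set} where

  map-++⁻ : (f : A → B) → ∀ p (as bs : List B) → map f p ≡ as ++ bs →
            Σ (List A) λ p₁ → Σ (List A) λ p₂ → (p ≡ p₁ ++ p₂) × (map f p₁ ≡ as) × (map f p₂ ≡ bs)
  map-++⁻ f p       []       bs eq = [] , p , refl , refl , eq
  map-++⁻ f (x ∷ p) (a ∷ as) bs eq with map-++⁻ f p as bs (∷-injectiveʳ eq)
  ... | p₁ , p₂ , refl , eq₁ , eq₂ = x ∷ p₁ , p₂ , refl , cong₂ _∷_ (∷-injectiveˡ eq) eq₁ , eq₂

  Unique-map⁺-on : (f : A → B) → ∀ {xs} → Unique xs → (∀ {a b} → a ∈ xs → b ∈ xs → f a ≡ f b → a ≡ b) →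
                   Unique (map f xs)
  Unique-map⁺-on f {[]}     []       _   = []
  Unique-map⁺-on f {x ∷ xs} (x∉ ∷ u) inj =
    All.map⁺ (All.tabulate λ {b} b∈ fx≡fb → All.lookup x∉ b∈ (inj (here refl) (there b∈) fx≡fb)) ∷
    Unique-map⁺-on f u (λ a∈ b∈ → inj (there a∈) (there b∈))

  injection⇒length≤ : (f : A → B) → ∀ {xs ys} → Unique xs →
                      (∀ {a b} → a ∈ xs → b ∈ xs → f a ≡ f b → a ≡ b) → (∀ {a} → a ∈ xs → f a ∈ ys) →
                      length xs ≤ length ys
  injection⇒length≤ f {xs} {ys} u inj into = subst (_≤ _) (length-map f xs)
    (Unique-⊆⇒length≤ (Unique-map⁺-on f u inj) image⊆ys)
    where
    image⊆ys : ∀ {z} → z ∈ map f xs → z ∈ ys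
    image⊆ys z∈ with a , a∈ , refl ← ∈-map⁻ f z∈ = into a∈

  length-cartesianProduct : ∀ (xs : List A) (ys : List B) → length (cartesianProduct xs ys) ≡ length xs * length ys
  length-cartesianProduct []       ys = refl
  length-cartesianProduct (x ∷ xs) ys =
    trans (length-++ (map (x ,_) ys)) (cong₂ _+_ (length-map (x ,_) ys) (length-cartesianProduct xs ys))

  *-length-concatMap≤ : (g : A → List B) → ∀ xs c bound → (∀ {z} → z ∈ xs → c * length (g z) ≤ bound) →
                        c * length (concatMap g xs) ≤ length xs * bound
  *-length-concatMap≤ g []       c bound _ = ≤-reflexive (*-zeroʳ c)
  *-length-concatMap≤ g (x ∷ xs) c bound h = begin
    c * length (g x ++ concatMap g xs)            ≡⟨ cong (c *_) (length-++ (g x)) ⟩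
    c * (length (g x) + length (concatMap g xs))  ≡⟨ *-distribˡ-+ c (length (g x)) _ ⟩
    c * length (g x) + c * length (concatMap g xs)
      ≤⟨ +-mono-≤ (h (here refl)) (*-length-concatMap≤ g xs c bound (h ∘ there)) ⟩
    bound + length xs * bound                     ∎
    where open ≤-Reasoning

  length-concatMap≤ : (g : A → List B) → ∀ xs bound → (∀ {z} → z ∈ xs → length (g z) ≤ bound) →
                      length (concatMap g xs) ≤ length xs * bound
  length-concatMap≤ g xs bound h =
    subst (_≤ _) (*-identityˡ _) (*-length-concatMap≤ g xs 1 bound (λ z∈ → subst (_≤ _) (sym (*-identityˡ _)) (h z∈)))

  length-concatMap : (g : A → List B) → ∀ xs → length (concatMap g xs) ≡ sum (map (length ∘ g) xs)
  length-concatMap g []       = refl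
  length-concatMap g (x ∷ xs) = trans (length-++ (g x)) (cong (length (g x) +_) (length-concatMap g xs))

module _ {A : Set} where

  allVecs : ∀ k → (Fin k → List A) → List (Vec A k)
  allVecs zero    f = [] ∷ []
  allVecs (suc k) f = cartesianProductWith _∷_ (f zero) (allVecs k (λ i → f (suc i)))

  ∈-allVecs⁺ : ∀ k f (v : Vec A k) → (∀ i → lookup v i ∈ f i) → v ∈ allVecs k f
  ∈-allVecs⁺ zero    f []      _ = here refl
  ∈-allVecs⁺ (suc k) f (a ∷ v) h =
    ∈-cartesianProductWith⁺ _∷_ (h zero) (∈-allVecs⁺ k (λ i → f (suc i)) v (λ i → h (suc i)))

  ∈-allVecs⁻ : ∀ k f (v : Vec A k) → v ∈ allVecs k f → ∀ i → lookup v i ∈ f i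
  ∈-allVecs⁻ (suc k) f v p i with ∈-cartesianProductWith⁻ _∷_ (f zero) (allVecs k (λ i → f (suc i))) p
  ∈-allVecs⁻ (suc k) f _ p zero    | a , w , a∈ , w∈ , refl = a∈
  ∈-allVecs⁻ (suc k) f _ p (suc i) | a , w , a∈ , w∈ , refl = ∈-allVecs⁻ k (λ i → f (suc i)) w w∈ i

  allVecs-unique : ∀ k f → (∀ i → Unique (f i)) → Unique (allVecs k f)
  allVecs-unique zero    f _ = [] ∷ []
  allVecs-unique (suc k) f u =
    Unique.cartesianProductWith⁺ _∷_ Vec.∷-injective (u zero) (allVecs-unique k (λ i → f (suc i)) (λ i → u (suc i)))

module _ {A : Set} where

  SquareInfix : List A → Set
  SquareInfix s = Σ (List A) λ a → Σ (List A) λ u → Σ (List A) λ b → (u ≢ []) × (s ≡ a ++ (u ++ u) ++ b)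

  nonEmptyPrefixes : List A → List (List A)
  nonEmptyPrefixes []      = []
  nonEmptyPrefixes (z ∷ s) = (z ∷ []) ∷ map (z ∷_) (nonEmptyPrefixes s)

  ∈-nonEmptyPrefixes⁺ : ∀ u {r} → u ≢ [] → u ∈ nonEmptyPrefixes (u ++ r)
  ∈-nonEmptyPrefixes⁺ []           u≢[] = ⊥-elim (u≢[] refl)
  ∈-nonEmptyPrefixes⁺ (x ∷ [])     _    = here refl
  ∈-nonEmptyPrefixes⁺ (x ∷ y ∷ u)  _    = there (∈-map⁺ (x ∷_) (∈-nonEmptyPrefixes⁺ (y ∷ u) λ ()))

  ∈-nonEmptyPrefixes⁻ : ∀ {u} s → u ∈ nonEmptyPrefixes s → u ≢ []
  ∈-nonEmptyPrefixes⁻ (z ∷ s) (here refl) ()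
  ∈-nonEmptyPrefixes⁻ (z ∷ s) (there p) with ∈-map⁻ (z ∷_) p
  ... | _ , _ , refl = λ ()

  module _ (_≟_ : DecidableEquality A) where

    prefix? : (xs ys : List A) → Dec (∃ λ r → ys ≡ xs ++ r)
    prefix? []       ys       = yes (ys , refl)
    prefix? (x ∷ xs) []       = no λ ()
    prefix? (x ∷ xs) (y ∷ ys) with x ≟ y | prefix? xs ys
    ... | yes refl | yes (r , eq) = yes (r , cong (x ∷_) eq)
    ... | yes refl | no ¬p        = no λ (r , eq) → ¬p (r , ∷-injectiveʳ eq)
    ... | no x≢y   | _            = no λ (r , eq) → x≢y (sym (∷-injectiveˡ eq))

    findSquarePrefix : ∀ s us → (∀ {u} → u ∈ us → ¬ ∃ λ r → s ≡ (u ++ u) ++ r) ⊎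
                                (∃ λ u → u ∈ us × ∃ λ r → s ≡ (u ++ u) ++ r)
    findSquarePrefix s []       = inj₁ λ ()
    findSquarePrefix s (u ∷ us) with prefix? (u ++ u) s | findSquarePrefix s us
    ... | yes sq | _                     = inj₂ (u , here refl , sq)
    ... | no ¬sq | inj₂ (v , v∈ , sq)    = inj₂ (v , there v∈ , sq)
    ... | no ¬sq | inj₁ none             = inj₁ λ { (here refl) → ¬sq ; (there v∈) → none v∈ }

    nonRepetitive⊎squareInfix : (s : List A) → NonRepetitive s ⊎ SquareInfix s
    nonRepetitive⊎squareInfix [] =
      inj₁ λ { [] [] _ refl ([] , u≢[] , _) → u≢[] refl ; [] (_ ∷ _) _ () ; (_ ∷ _) _ _ () }
    nonRepetitive⊎squareInfix (z ∷ s) with findSquarePrefix (z ∷ s) (nonEmptyPrefixes (z ∷ s))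
    ... | inj₂ (u , u∈ , r , eq) = inj₂ ([] , u , r , ∈-nonEmptyPrefixes⁻ (z ∷ s) u∈ , eq)
    ... | inj₁ noSquarePrefix with nonRepetitive⊎squareInfix s
    ...   | inj₂ (a , u , b , u≢[] , eq) = inj₂ (z ∷ a , u , b , u≢[] , cong (z ∷_) eq)
    ...   | inj₁ nr = inj₁ nonRepetitive
      where
      nonRepetitive : NonRepetitive (z ∷ s)
      nonRepetitive []      w b eq (u , u≢[] , refl) =
        noSquarePrefix
          (subst (λ s → u ∈ nonEmptyPrefixes s) (sym (trans eq (++-assoc u u b))) (∈-nonEmptyPrefixes⁺ u u≢[]))
          (b , eq)
      nonRepetitive (_ ∷ a) w b eq sq = nr a w b (∷-injectiveʳ eq) sq

-- Σ_{j<M} (j+1)/3^j = 9/4 − (2M+3)/(4·3^(M−1)); the invariant is this identity multiplied by 4·3^M.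
sum≤3*bound : ∀ (v : ℕ → ℕ) B M → (∀ {j} → j < M → 3 ^ j * v j ≤ suc j * B) → sum (map v (downFrom M)) ≤ 3 * B
sum≤3*bound v B M hyp = *-cancelˡ-≤ 4 (begin
  4 * S M      ≤⟨ 4S≤9B ⟩
  9 * B        ≤⟨ *-monoˡ-≤ B (+-monoʳ-≤ 9 (z≤n {3})) ⟩
  12 * B       ≡⟨ *-assoc 4 3 B ⟩
  4 * (3 * B)  ∎)
  where
  open ≤-Reasoning
  S : ℕ → ℕ
  S N = sum (map v (downFrom N))
  solve0 : ∀ B → 4 * 1 * 0 + 3 * (2 * 0 + 3) * B ≡ 9 * 1 * B
  solve0 = solve-∀
  solve1 : ∀ X S → X * (4 * S) ≡ 4 * X * S
  solve1 = solve-∀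
  solve2 : ∀ X B → 9 * X * B ≡ X * (9 * B)
  solve2 = solve-∀
  solve3 : ∀ X v S N B → 4 * (3 * X) * (v + S) + 3 * (2 * suc N + 3) * B ≡
                         12 * (X * v) + (3 * (4 * X * S) + (6 * N + 15) * B)
  solve3 = solve-∀
  solve4 : ∀ X S N B → 12 * (suc N * B) + (3 * (4 * X * S) + (6 * N + 15) * B) ≡
                       3 * (4 * X * S + 3 * (2 * N + 3) * B)
  solve4 = solve-∀
  solve5 : ∀ X B → 3 * (9 * X * B) ≡ 9 * (3 * X) * B
  solve5 = solve-∀
  invariant : ∀ N → N ≤ M → 4 * 3 ^ N * S N + 3 * (2 * N + 3) * B ≤ 9 * 3 ^ N * B
  invariant zero    _   = ≤-reflexive (solve0 B)
  invariant (suc N) N<M = begin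
    4 * (3 * X) * (v N + S N) + 3 * (2 * suc N + 3) * B       ≡⟨ solve3 X (v N) (S N) N B ⟩
    12 * (X * v N) + (3 * (4 * X * S N) + (6 * N + 15) * B)   ≤⟨ +-monoˡ-≤ _ (*-monoʳ-≤ 12 (hyp N<M)) ⟩
    12 * (suc N * B) + (3 * (4 * X * S N) + (6 * N + 15) * B) ≡⟨ solve4 X (S N) N B ⟩
    3 * (4 * X * S N + 3 * (2 * N + 3) * B)                   ≤⟨ *-monoʳ-≤ 3 (invariant N (≤-trans (n≤1+n N) N<M)) ⟩
    3 * (9 * X * B)                                           ≡⟨ solve5 X B ⟩
    9 * (3 * X) * B                                           ∎
    where X = 3 ^ N
  4S≤9B : 4 * S M ≤ 9 * B
  4S≤9B = *-cancelˡ-≤ (3 ^ M) {{m^n≢0 3 M}} (begin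
    3 ^ M * (4 * S M)                     ≡⟨ solve1 (3 ^ M) (S M) ⟩
    4 * 3 ^ M * S M                       ≤⟨ m≤m+n _ _ ⟩
    4 * 3 ^ M * S M + 3 * (2 * M + 3) * B ≤⟨ invariant M ≤-refl ⟩
    9 * 3 ^ M * B                         ≡⟨ solve2 (3 ^ M) B ⟩
    3 ^ M * (9 * B)                       ∎)

^-distribʳ-* : ∀ a b k → (a * b) ^ k ≡ a ^ k * b ^ k
^-distribʳ-* a b zero    = refl
^-distribʳ-* a b (suc k) = begin
  a * b * (a * b) ^ k      ≡⟨ cong (a * b *_) (^-distribʳ-* a b k) ⟩
  a * b * (a ^ k * b ^ k)  ≡⟨ solve a b (a ^ k) (b ^ k) ⟩
  a * a ^ k * (b * b ^ k)  ∎
  where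
  open ≡-Reasoning
  solve : ∀ a b x y → a * b * (x * y) ≡ a * x * (b * y)
  solve = solve-∀

even⊎odd : ∀ i → ∃ λ a → i ≡ a + a ⊎ i ≡ suc (a + a)
even⊎odd zero    = 0 , inj₁ refl
even⊎odd (suc i) with even⊎odd i
... | a , inj₁ refl = a , inj₂ refl
... | a , inj₂ refl = suc a , inj₁ (cong suc (sym (+-suc a a)))

a+a≡2*a : ∀ a → a + a ≡ 2 * a
a+a≡2*a a = cong (a +_) (sym (+-identityʳ a))

odd≢even : ∀ a b → suc (a + a) ≢ b + b
odd≢even a b eq = even≢odd b a (trans (sym (a+a≡2*a b)) (trans (sym eq) (cong suc (a+a≡2*a a))))

double-injective : ∀ a b → a + a ≡ b + b → a ≡ b
double-injective a b eq = *-cancelˡ-≡ a b 2 (trans (sym (a+a≡2*a a)) (trans eq (a+a≡2*a b)))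

parity-product≤ : ∀ (f : ℕ → ℕ) Δ → (∀ a b → f (a + a) * f (suc (b + b)) ≤ Δ ^ (a + suc b)) →
                  ∀ i j k → suc (i + j) ≡ k + k → f i * f j ≤ Δ ^ k
parity-product≤ f Δ bound i j k eq with even⊎odd i | even⊎odd j
... | a , inj₁ refl | b , inj₁ refl = ⊥-elim (odd≢even (a + b) k (trans (cong suc (solve a b)) eq))
  where
  solve : ∀ a b → (a + b) + (a + b) ≡ (a + a) + (b + b)
  solve = solve-∀
... | a , inj₂ refl | b , inj₂ refl = ⊥-elim (odd≢even (suc (a + b)) k (trans (cong suc (solve a b)) eq))
  where
  solve : ∀ a b → suc (a + b) + suc (a + b) ≡ suc (a + a) + suc (b + b)
  solve = solve-∀
... | a , inj₁ refl | b , inj₂ refl with double-injective k (a + suc b) (trans (sym eq) (solve a b))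
  where
  solve : ∀ a b → suc ((a + a) + suc (b + b)) ≡ (a + suc b) + (a + suc b)
  solve = solve-∀
...   | refl = bound a b
parity-product≤ f Δ bound i j k eq | a , inj₂ refl | b , inj₁ refl
  with double-injective k (b + suc a) (trans (sym eq) (solve a b))
  where
  solve : ∀ a b → suc (suc (a + a) + (b + b)) ≡ (b + suc a) + (b + suc a)
  solve = solve-∀
...   | refl = subst (_≤ Δ ^ (b + suc a)) (*-comm (f (b + b)) (f (suc (a + a)))) (bound b a)

-- Bounds on the number of non-backtracking walks of s steps in the incidence graph of a graph of maximum
-- degree at most d + 1, from a vertex or from an edge; the flag is true when the first step may not
-- return to a given predecessor.
module WalkBound (d : ℕ) where

  Δ : ℕ
  Δ = suc (suc d)

  vertexWalks edgeWalks : Bool → ℕ → ℕ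
  vertexWalks _     zero    = 1
  vertexWalks true  (suc s) = d * edgeWalks true s
  vertexWalks false (suc s) = suc d * edgeWalks true s
  edgeWalks   _     zero    = 1
  edgeWalks   true  (suc s) = vertexWalks true s
  edgeWalks   false (suc s) = 2 * vertexWalks true s

  walks-even : ∀ t → vertexWalks true (t + t) ≡ d ^ t × edgeWalks true (t + t) ≡ d ^ t
  walks-even zero = refl , refl
  walks-even (suc t) rewrite +-suc t t with v≡ , e≡ ← walks-even t = cong (d *_) v≡ , cong (d *_) e≡

  vertexWalks-odd : ∀ t → vertexWalks true (suc (t + t)) ≡ d ^ suc t
  vertexWalks-odd t = cong (d *_) (proj₂ (walks-even t))

  d^t≤Δ^t : ∀ t → d ^ t ≤ Δ ^ t
  d^t≤Δ^t t = ^-monoˡ-≤ t (≤-trans (n≤1+n d) (n≤1+n (suc d)))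

  vertexWalks-even≤ : ∀ a → vertexWalks false (a + a) ≤ suc d ^ a
  vertexWalks-even≤ zero    = ≤-refl
  vertexWalks-even≤ (suc a) rewrite +-suc a a =
    *-monoʳ-≤ (suc d) (≤-trans (≤-reflexive (proj₁ (walks-even a))) (^-monoˡ-≤ a (n≤1+n d)))

  vertexWalks-odd≤ : ∀ b → vertexWalks false (suc (b + b)) ≤ suc d ^ suc b
  vertexWalks-odd≤ b = *-monoʳ-≤ (suc d) (≤-trans (≤-reflexive (proj₂ (walks-even b))) (^-monoˡ-≤ b (n≤1+n d)))

  vertexWalks-product≤ : ∀ a b → vertexWalks false (a + a) * vertexWalks false (suc (b + b)) ≤ Δ ^ (a + suc b)
  vertexWalks-product≤ a b = begin
    vertexWalks false (a + a) * vertexWalks false (suc (b + b))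
      ≤⟨ *-mono-≤ (vertexWalks-even≤ a) (vertexWalks-odd≤ b) ⟩
    suc d ^ a * suc d ^ suc b                                 ≡⟨ ^-distribˡ-+-* (suc d) a (suc b) ⟨
    suc d ^ (a + suc b)                                       ≤⟨ ^-monoˡ-≤ (a + suc b) (n≤1+n (suc d)) ⟩
    Δ ^ (a + suc b)                                           ∎
    where open ≤-Reasoning

  edgeWalks-product≤ : ∀ a b → edgeWalks false (a + a) * edgeWalks false (suc (b + b)) ≤ Δ ^ (a + suc b)
  edgeWalks-product≤ zero b = begin
    1 * (2 * vertexWalks true (b + b)) ≡⟨ *-identityˡ _ ⟩
    2 * vertexWalks true (b + b)       ≡⟨ cong (2 *_) (proj₁ (walks-even b)) ⟩
    2 * d ^ b                          ≤⟨ *-mono-≤ (s≤s (s≤s (z≤n {d}))) (d^t≤Δ^t b) ⟩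
    Δ ^ suc b                          ∎
    where open ≤-Reasoning
  edgeWalks-product≤ (suc a) b rewrite +-suc a a = begin
    2 * vertexWalks true (suc (a + a)) * (2 * vertexWalks true (b + b))
      ≡⟨ cong₂ (λ u w → 2 * u * (2 * w)) (vertexWalks-odd a) (proj₁ (walks-even b)) ⟩
    2 * d ^ suc a * (2 * d ^ b)        ≡⟨ solve1 d (d ^ a) (d ^ b) ⟩
    4 * d * (d ^ a * d ^ b)            ≡⟨ cong (4 * d *_) (^-distribˡ-+-* d a b) ⟨
    4 * d * d ^ (a + b)                ≤⟨ *-mono-≤ 4d≤Δ² (d^t≤Δ^t (a + b)) ⟩
    Δ * Δ * Δ ^ (a + b)                ≡⟨ *-assoc Δ Δ (Δ ^ (a + b)) ⟩
    Δ ^ suc (suc (a + b))              ≡⟨ cong (λ n → Δ ^ suc n) (+-suc a b) ⟨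
    Δ ^ (suc a + suc b)                ∎
    where
    open ≤-Reasoning
    solve1 : ∀ d x y → 2 * (d * x) * (2 * y) ≡ 4 * d * (x * y)
    solve1 = solve-∀
    solve2 : ∀ d → (d * d + 4) + 4 * d ≡ suc (suc d) * suc (suc d)
    solve2 = solve-∀
    4d≤Δ² : 4 * d ≤ Δ * Δ
    4d≤Δ² = ≤-trans (m≤n+m (4 * d) (d * d + 4)) (≤-reflexive (solve2 d))

module Incidence (G : Graph) where

  _≟ₑ_ : DecidableEquality (Elem G)
  _≟ₑ_ = ≡-dec⊎ _≟ᶠ_ _≟ᶠ_

  open import Data.List.Membership.DecPropositional _≟ₑ_ using (_∉?_) public
  open import Data.List.Relation.Unary.Unique.DecPropositional _≟ₑ_ using (unique?)

  elements : List (Elem G)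
  elements = map inj₁ (allFin (n G)) ++ map inj₂ (allFin (m G))

  ∈-elements : ∀ y → y ∈ elements
  ∈-elements (inj₁ v) = ∈-++⁺ˡ (∈-map⁺ inj₁ (∈-allFin v))
  ∈-elements (inj₂ e) = ∈-++⁺ʳ (map inj₁ (allFin (n G))) (∈-map⁺ inj₂ (∈-allFin e))

  Unique⇒length≤ : ∀ {p} → Unique p → length p ≤ length elements
  Unique⇒length≤ u = Unique-⊆⇒length≤ u (λ {z} _ → ∈-elements z)

  Inc? : ∀ y z → Dec (Inc G y z)
  Inc? (inj₁ v) (inj₁ w) = no λ ()
  Inc? (inj₁ v) (inj₂ e) = endOf? G v e
  Inc? (inj₂ e) (inj₁ v) = endOf? G v e
  Inc? (inj₂ e) (inj₂ f) = no λ ()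

  Inc-sym : ∀ {y z} → Inc G y z → Inc G z y
  Inc-sym {inj₁ v} {inj₂ e} i = i
  Inc-sym {inj₂ e} {inj₁ v} i = i

  neighbours : Elem G → List (Elem G)
  neighbours (inj₁ v) = map inj₂ (filter (endOf? G v) (allFin (m G)))
  neighbours (inj₂ e) = inj₁ (proj₁ (ends G e)) ∷ inj₁ (proj₂ (ends G e)) ∷ []

  ∈-neighbours⁺ : ∀ {y z} → Inc G y z → z ∈ neighbours y
  ∈-neighbours⁺ {inj₁ v} {inj₂ e} i          = ∈-map⁺ inj₂ (∈-filter⁺ (endOf? G v) (∈-allFin e) i)
  ∈-neighbours⁺ {inj₂ e} {inj₁ v} (inj₁ refl) = here refl
  ∈-neighbours⁺ {inj₂ e} {inj₁ v} (inj₂ refl) = there (here refl)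

  ∈-neighbours⁻ : ∀ {y z} → z ∈ neighbours y → Inc G y z
  ∈-neighbours⁻ {inj₁ v} p with e , e∈ , refl ← ∈-map⁻ inj₂ p = proj₂ (∈-filter⁻ (endOf? G v) {xs = allFin (m G)} e∈)
  ∈-neighbours⁻ {inj₂ e} (here refl)         = inj₁ refl
  ∈-neighbours⁻ {inj₂ e} (there (here refl)) = inj₂ refl

  -- A deleted set is represented by the list D of its elements; Path D is MixedPath G (_∈ D).
  Path : List (Elem G) → List (Elem G) → Set
  Path D p = Linked (Inc G) p × Unique p × All (_∉ D) p

  Path? : ∀ D p → Dec (Path D p)
  Path? D p = linked? Inc? p ×-dec (unique? p ×-dec all? (_∉? D) p)

  Path-infix : ∀ {D} a w b → Path D (a ++ w ++ b) → Path D w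
  Path-infix a w b (l , u , a∉) =
    Linked-++⁻ˡ w (Linked-++⁻ʳ a l) , Unique-++⁻ˡ w (Unique-++⁻ʳ a u) , All.++⁻ˡ w (All.++⁻ʳ a a∉)

  Path-reverse : ∀ {D p} → Path D p → Path D (reverse p)
  Path-reverse (l , u , a∉) =
    Linked.map Inc-sym (Linked-reverse⁺ l) , Unique-reverse⁺ u ,
    All.tabulate (λ z∈ → All.lookup a∉ (AnyP.reverse⁻ z∈))

  notBackTo? : (pr : Maybe (Elem G)) → ∀ z → Dec (pr ≢ just z)
  notBackTo? pr z = ¬? (≡-decᴹ _≟ₑ_ pr (just z))

  continuations : Maybe (Elem G) → Elem G → List (Elem G)
  continuations pr y = filter (notBackTo? pr) (neighbours y)

  ∈-continuations⁻ : ∀ {pr y z} → z ∈ continuations pr y → Inc G y z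
  ∈-continuations⁻ {pr} {y} z∈ = ∈-neighbours⁻ (proj₁ (∈-filter⁻ (notBackTo? pr) {xs = neighbours y} z∈))

  walks : Maybe (Elem G) → Elem G → ℕ → List (List (Elem G))
  walks pr y zero    = [] ∷ []
  walks pr y (suc s) = concatMap (λ z → map (z ∷_) (walks (just y) z s)) (continuations pr y)

  ∈-walks : ∀ pr y w → Linked (Inc G) (y ∷ w) → Unique (y ∷ w) → All (λ z → pr ≢ just z) w →
            w ∈ walks pr y (length w)
  ∈-walks pr y []      _       _        _          = here refl
  ∈-walks pr y (z ∷ w) (i ∷ l) (y∉ ∷ u) (z≢pr ∷ _) =
    ∈-concatMap⁺ (λ z → map (z ∷_) (walks (just y) z (length w)))
      (Any.map (λ { refl → ∈-map⁺ (z ∷_) (∈-walks (just y) z w l u (All.map (_∘ just-injective) (All.tail y∉))) })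
               (∈-filter⁺ (notBackTo? pr) (∈-neighbours⁺ i) z≢pr))

  module WalkCounting (d : ℕ) (deg : ∀ v → degree G v < suc (suc d)) where
    open WalkBound d

    walkBound : Elem G → Bool → ℕ → ℕ
    walkBound (inj₁ _) = vertexWalks
    walkBound (inj₂ _) = edgeWalks

    Excluding : Maybe (Elem G) → Elem G → Bool → Set
    Excluding pr y false = pr ≡ nothing
    Excluding pr y true  = ∃ λ p → pr ≡ just p × p ∈ neighbours y

    length-continuations≤ : ∀ pr y b k → Excluding pr y b → length (neighbours y) ≤ (if b then suc k else k) →
                            length (continuations pr y) ≤ k
    length-continuations≤ pr y false k refl ≤k = ≤-trans (length-filter _ (neighbours y)) ≤k
    length-continuations≤ pr y true  k (p , refl , p∈) ≤1+k =
      ≤-pred (≤-trans (filter-notAll _ (neighbours y) (Any.map (λ { refl ¬≢ → ¬≢ refl }) p∈)) ≤1+k)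

    length-walks-step≤ : ∀ s pr y B → (∀ {z} → z ∈ continuations pr y → length (walks (just y) z s) ≤ B) →
                         length (walks pr y (suc s)) ≤ length (continuations pr y) * B
    length-walks-step≤ s pr y B h = length-concatMap≤ _ (continuations pr y) B
      (λ {z} z∈ → subst (_≤ B) (sym (length-map (z ∷_) (walks (just y) z s))) (h z∈))

    length-walks≤ : ∀ s pr y b → Excluding pr y b → length (walks pr y s) ≤ walkBound y b s
    length-walks≤ zero    pr (inj₁ v) b ex = ≤-refl
    length-walks≤ zero    pr (inj₂ e) b ex = ≤-refl
    length-walks≤ (suc s) pr (inj₁ v) b ex =
      ≤-trans (length-walks-step≤ s pr (inj₁ v) (edgeWalks true s) next) (factor b ex)
      where
      next : ∀ {z} → z ∈ continuations pr (inj₁ v) → length (walks (just (inj₁ v)) z s) ≤ edgeWalks true s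
      next {inj₂ e} z∈ = length-walks≤ s _ (inj₂ e) true
        (inj₁ v , refl , ∈-neighbours⁺ {inj₂ e} (Inc-sym {inj₁ v} {inj₂ e} (∈-continuations⁻ {pr} {inj₁ v} z∈)))
      next {inj₁ w} z∈ = ⊥-elim (∈-continuations⁻ {pr} {inj₁ v} z∈)
      deg≤ : length (neighbours (inj₁ v)) ≤ suc d
      deg≤ = ≤-trans (≤-reflexive (length-map inj₂ (filter (endOf? G v) (allFin (m G))))) (≤-pred (deg v))
      factor : ∀ b → Excluding pr (inj₁ v) b →
               length (continuations pr (inj₁ v)) * edgeWalks true s ≤ vertexWalks b (suc s)
      factor false ex = *-monoˡ-≤ _ (length-continuations≤ pr (inj₁ v) false (suc d) ex deg≤)
      factor true  ex = *-monoˡ-≤ _ (length-continuations≤ pr (inj₁ v) true d ex deg≤)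
    length-walks≤ (suc s) pr (inj₂ e) b ex =
      ≤-trans (length-walks-step≤ s pr (inj₂ e) (vertexWalks true s) next) (factor b ex)
      where
      next : ∀ {z} → z ∈ continuations pr (inj₂ e) → length (walks (just (inj₂ e)) z s) ≤ vertexWalks true s
      next {inj₁ v} z∈ = length-walks≤ s _ (inj₁ v) true
        (inj₂ e , refl , ∈-neighbours⁺ {inj₁ v} (Inc-sym {inj₂ e} {inj₁ v} (∈-continuations⁻ {pr} {inj₂ e} z∈)))
      next {inj₂ f} z∈ = ⊥-elim (∈-continuations⁻ {pr} {inj₂ e} z∈)
      factor : ∀ b → Excluding pr (inj₂ e) b →
               length (continuations pr (inj₂ e)) * vertexWalks true s ≤ edgeWalks b (suc s)
      factor false ex = *-monoˡ-≤ _ (length-continuations≤ pr (inj₂ e) false 2 ex ≤-refl)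
      factor true  ex = subst (length (continuations pr (inj₂ e)) * vertexWalks true s ≤_) (*-identityˡ _)
                              (*-monoˡ-≤ _ (length-continuations≤ pr (inj₂ e) true 1 ex ≤-refl))

    walkBound-product≤ : ∀ y i j k → suc (i + j) ≡ k + k → walkBound y false i * walkBound y false j ≤ Δ ^ k
    walkBound-product≤ (inj₁ _) = parity-product≤ (vertexWalks false) Δ vertexWalks-product≤
    walkBound-product≤ (inj₂ _) = parity-product≤ (edgeWalks false) Δ edgeWalks-product≤

    -- A path of 2(k+1) elements with x among its first k+1 is reverse l ++ x ∷ r for walks l, r leaving x.
    pathsAt : Elem G → ℕ → ℕ → List (List (Elem G))
    pathsAt x k i =
      concatMap (λ l → map (λ r → reverse l ++ x ∷ r) (walks nothing x (suc (k + k) ∸ i))) (walks nothing x i)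

    pathsThrough : Elem G → ℕ → List (List (Elem G))
    pathsThrough x k = concatMap (pathsAt x k) (downFrom (suc k))

    length-pathsThrough≤ : ∀ x k → length (pathsThrough x k) ≤ suc k * Δ ^ suc k
    length-pathsThrough≤ x k =
      ≤-trans (length-concatMap≤ (pathsAt x k) (downFrom (suc k)) (Δ ^ suc k) perPosition)
              (≤-reflexive (cong (_* Δ ^ suc k) (length-downFrom (suc k))))
      where
      perPosition : ∀ {i} → i ∈ downFrom (suc k) → length (pathsAt x k i) ≤ Δ ^ suc k
      perPosition {i} i∈ = begin
        length (pathsAt x k i)                           ≤⟨ length-concatMap≤ _ (walks nothing x i) _ rights ⟩
        length (walks nothing x i) * walkBound x false j ≤⟨ *-monoˡ-≤ _ (length-walks≤ i nothing x false refl) ⟩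
        walkBound x false i * walkBound x false j        ≤⟨ walkBound-product≤ x i j (suc k) (cong suc i+j≡) ⟩
        Δ ^ suc k                                        ∎
        where
        open ≤-Reasoning
        j = suc (k + k) ∸ i
        i+j≡ : i + j ≡ k + suc k
        i+j≡ = trans (m+[n∸m]≡n (≤-trans (≤-pred (∈-downFrom⁻ i∈)) (≤-trans (m≤m+n k k) (n≤1+n _)))) (sym (+-suc k k))
        rights : ∀ {l} → l ∈ walks nothing x i →
                 length (map (λ r → reverse l ++ x ∷ r) (walks nothing x j)) ≤ walkBound x false j
        rights _ = ≤-trans (≤-reflexive (length-map _ (walks nothing x j))) (length-walks≤ j nothing x false refl)

    ∈-walks-after : ∀ {x} pre r → Linked (Inc G) (pre ++ x ∷ r) → Unique (pre ++ x ∷ r) →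
                    r ∈ walks nothing x (length r)
    ∈-walks-after {x} pre r l u = ∈-walks nothing x r (Linked-++⁻ʳ pre l) (Unique-++⁻ʳ pre u) (All.tabulate λ _ ())

    ∈-walks-before : ∀ {x} pre r → Linked (Inc G) (pre ++ x ∷ r) → Unique (pre ++ x ∷ r) →
                     reverse pre ∈ walks nothing x (length pre)
    ∈-walks-before {x} pre r l u = subst (λ n → reverse pre ∈ walks nothing x n) (length-reverse pre)
      (∈-walks-after (reverse r) (reverse pre)
        (subst (Linked (Inc G)) rev (Linked.map Inc-sym (Linked-reverse⁺ l))) (subst Unique rev (Unique-reverse⁺ u)))
      where
      rev : reverse (pre ++ x ∷ r) ≡ reverse r ++ x ∷ reverse pre
      rev = begin
        reverse (pre ++ x ∷ r)               ≡⟨ reverse-++ pre (x ∷ r) ⟩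
        reverse (x ∷ r) ++ reverse pre       ≡⟨ cong (_++ reverse pre) (unfold-reverse x r) ⟩
        (reverse r ++ x ∷ []) ++ reverse pre ≡⟨ ++-assoc (reverse r) (x ∷ []) (reverse pre) ⟩
        reverse r ++ x ∷ reverse pre         ∎
        where open ≡-Reasoning

    ∈-pathsAt : ∀ {x k i l r} → l ∈ walks nothing x i → r ∈ walks nothing x (suc (k + k) ∸ i) →
                reverse l ++ x ∷ r ∈ pathsAt x k i
    ∈-pathsAt {x} {k} {i} l∈ r∈ =
      ∈-concatMap⁺ (λ l → map (λ r → reverse l ++ x ∷ r) (walks nothing x (suc (k + k) ∸ i)))
                   (Any.map (λ { refl → ∈-map⁺ _ r∈ }) l∈)

    ∈-pathsThrough : ∀ x k q → length q ≡ suc k + suc k → x ∈ take (suc k) q → Linked (Inc G) q → Unique q →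
                     q ∈ pathsThrough x k
    ∈-pathsThrough x k q lq x∈ l u with pre , r , refl , pre<k ← ∈-take⇒split (suc k) q x∈ =
      ∈-concatMap⁺ (pathsAt x k) (Any.map (λ { refl → atPosition }) (∈-downFrom⁺ pre<k))
      where
      lr≡ : length r ≡ suc (k + k) ∸ length pre
      lr≡ = sym (begin
        suc (k + k) ∸ length pre                   ≡⟨ cong (_∸ length pre) (+-suc k k) ⟨
        (suc k + suc k) ∸ suc (length pre)         ≡⟨ cong (_∸ suc (length pre)) (sym lq) ⟩
        length (pre ++ x ∷ r) ∸ suc (length pre)   ≡⟨ cong (_∸ suc (length pre)) (length-++ pre) ⟩
        length pre + suc (length r) ∸ suc (length pre) ≡⟨ cong (_∸ suc (length pre)) (+-suc (length pre) (length r)) ⟩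
        length pre + length r ∸ length pre         ≡⟨ m+n∸m≡n (length pre) (length r) ⟩
        length r                                   ∎)
        where open ≡-Reasoning
      atPosition : pre ++ x ∷ r ∈ pathsAt x k (length pre)
      atPosition = subst (λ p → p ++ x ∷ r ∈ pathsAt x k (length pre)) (reverse-involutive pre)
        (∈-pathsAt {k = k} {i = length pre} (∈-walks-before pre r l u)
                   (subst (λ n → r ∈ walks nothing x n) lr≡ (∈-walks-after pre r l u)))

module Colourings (G : Graph) (L : Elem G → List ℕ) (L-unique : ∀ y → Unique (L y)) where

  open Incidence G
  open import Data.List.Membership.DecPropositional _≟ₑ_ using (_∈?_)

  col : Coloring G → Elem G → Maybe ℕ
  col = colAt G

  fromFunction : (Elem G → Maybe ℕ) → Coloring G
  fromFunction f = tabulate (λ i → f (inj₁ i)) , tabulate (λ i → f (inj₂ i))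

  col-fromFunction : ∀ f y → col (fromFunction f) y ≡ f y
  col-fromFunction f (inj₁ v) = Vec.lookup∘tabulate _ v
  col-fromFunction f (inj₂ e) = Vec.lookup∘tabulate _ e

  col-injective : ∀ {c₁ c₂} → (∀ y → col c₁ y ≡ col c₂ y) → c₁ ≡ c₂
  col-injective {v₁ , e₁} {v₂ , e₂} c₁≗c₂ = cong₂ _,_
    (trans (sym (Vec.tabulate∘lookup v₁)) (trans (Vec.tabulate-cong (λ i → c₁≗c₂ (inj₁ i))) (Vec.tabulate∘lookup v₂)))
    (trans (sym (Vec.tabulate∘lookup e₁)) (trans (Vec.tabulate-cong (λ i → c₁≗c₂ (inj₂ i))) (Vec.tabulate∘lookup e₂)))

  paint : Coloring G → List (Elem G) → Maybe ℕ → Coloring G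
  paint c zs v = fromFunction λ y → if does (y ∈? zs) then v else col c y

  col-paint-∈ : ∀ c zs v {y} → y ∈ zs → col (paint c zs v) y ≡ v
  col-paint-∈ c zs v {y} y∈ rewrite col-fromFunction (λ y → if does (y ∈? zs) then v else col c y) y with y ∈? zs
  ... | yes _ = refl
  ... | no y∉ = ⊥-elim (y∉ y∈)

  col-paint-∉ : ∀ c zs v {y} → y ∉ zs → col (paint c zs v) y ≡ col c y
  col-paint-∉ c zs v {y} y∉ rewrite col-fromFunction (λ y → if does (y ∈? zs) then v else col c y) y with y ∈? zs
  ... | yes y∈ = ⊥-elim (y∉ y∈)
  ... | no _   = refl

  Admissible : List (Elem G) → Elem G → Maybe ℕ → Set
  Admissible D y v = (y ∈ D × v ≡ nothing) ⊎ (y ∉ D × ∃ λ k → v ≡ just k × k ∈ L y)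

  NonRepetitiveOn : List (Elem G) → Coloring G → Set
  NonRepetitiveOn D c = ∀ p → Path D p → NonRepetitive (map (col c) p)

  Valid : List (Elem G) → Coloring G → Set
  Valid D c = (∀ y → Admissible D y (col c y)) × NonRepetitiveOn D c

  Admissible-∈ : ∀ {D y v} → Admissible D y v → y ∈ D → v ≡ nothing
  Admissible-∈ (inj₁ (_ , v≡)) _   = v≡
  Admissible-∈ (inj₂ (y∉ , _)) y∈ = ⊥-elim (y∉ y∈)

  Admissible-∉ : ∀ {D y v} → Admissible D y v → y ∉ D → ∃ λ k → v ≡ just k × k ∈ L y
  Admissible-∉ (inj₁ (y∈ , _)) y∉ = ⊥-elim (y∉ y∈)
  Admissible-∉ (inj₂ (_ , v≡)) _  = v≡

  Admissible-resp : ∀ {D₁ D₂ y v} → (y ∈ D₁ → y ∈ D₂) → (y ∈ D₂ → y ∈ D₁) → Admissible D₁ y v → Admissible D₂ y v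
  Admissible-resp to _    (inj₁ (y∈ , v≡)) = inj₁ (to y∈ , v≡)
  Admissible-resp _  from (inj₂ (y∉ , v≡)) = inj₂ (y∉ ∘ from , v≡)

  candidates : List (Elem G) → Elem G → List (Maybe ℕ)
  candidates D y with y ∈? D
  ... | yes _ = nothing ∷ []
  ... | no _  = map just (L y)

  ∈-candidates⁺ : ∀ {D y v} → Admissible D y v → v ∈ candidates D y
  ∈-candidates⁺ {D} {y} adm with y ∈? D
  ... | yes y∈ = here (Admissible-∈ adm y∈)
  ... | no y∉ with k , refl , k∈ ← Admissible-∉ adm y∉ = ∈-map⁺ just k∈

  ∈-candidates⁻ : ∀ {D y v} → v ∈ candidates D y → Admissible D y v
  ∈-candidates⁻ {D} {y} v∈ with y ∈? D
  ∈-candidates⁻ (here refl) | yes y∈ = inj₁ (y∈ , refl)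
  ... | no y∉ with k , k∈ , refl ← ∈-map⁻ just v∈ = inj₂ (y∉ , k , refl , k∈)

  candidates-unique : ∀ D y → Unique (candidates D y)
  candidates-unique D y with y ∈? D
  ... | yes _ = [] ∷ []
  ... | no _  = Unique.map⁺ just-injective (L-unique y)

  admissibleColourings : List (Elem G) → List (Coloring G)
  admissibleColourings D =
    cartesianProduct (allVecs (n G) (λ i → candidates D (inj₁ i))) (allVecs (m G) (λ i → candidates D (inj₂ i)))

  ∈-admissibleColourings⁺ : ∀ {D c} → (∀ y → Admissible D y (col c y)) → c ∈ admissibleColourings D
  ∈-admissibleColourings⁺ {D} {cv , ce} adm = ∈-cartesianProduct⁺
    (∈-allVecs⁺ (n G) _ cv (λ i → ∈-candidates⁺ (adm (inj₁ i))))
    (∈-allVecs⁺ (m G) _ ce (λ i → ∈-candidates⁺ (adm (inj₂ i))))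

  ∈-admissibleColourings⁻ : ∀ {D c} → c ∈ admissibleColourings D → ∀ y → Admissible D y (col c y)
  ∈-admissibleColourings⁻ {D} {cv , ce} c∈ (inj₁ v) =
    ∈-candidates⁻ (∈-allVecs⁻ (n G) _ cv (proj₁ (∈-cartesianProduct⁻ (allVecs (n G) _) (allVecs (m G) _) c∈)) v)
  ∈-admissibleColourings⁻ {D} {cv , ce} c∈ (inj₂ e) =
    ∈-candidates⁻ (∈-allVecs⁻ (m G) _ ce (proj₂ (∈-cartesianProduct⁻ (allVecs (n G) _) (allVecs (m G) _) c∈)) e)

  admissibleColourings-unique : ∀ D → Unique (admissibleColourings D)
  admissibleColourings-unique D = Unique.cartesianProduct⁺
    (allVecs-unique (n G) _ (λ i → candidates-unique D (inj₁ i)))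
    (allVecs-unique (m G) _ (λ i → candidates-unique D (inj₂ i)))

  SquarePath : List (Elem G) → Coloring G → Set
  SquarePath D c = Σ (List (Elem G)) λ h → Σ (List (Elem G)) λ t →
                   h ≢ [] × length h ≡ length t × Path D (h ++ t) × map (col c) h ≡ map (col c) t

  SquarePath⇒¬NonRepetitiveOn : ∀ {D c} → SquarePath D c → ¬ NonRepetitiveOn D c
  SquarePath⇒¬NonRepetitiveOn {c = c} (h , t , h≢[] , _ , path , h≈t) nonRep =
    nonRep (h ++ t) path [] (map (col c) (h ++ t)) [] (sym (++-identityʳ _))
      (map (col c) h , (λ eq → h≢[] (map-≡[] h eq)) , trans (map-++ (col c) h t) (cong (map (col c) h ++_) (sym h≈t)))
    where
    map-≡[] : ∀ xs → map (col c) xs ≡ [] → xs ≡ []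
    map-≡[] [] _ = refl

  squareInfix⇒SquarePath : ∀ {D c p} → Path D p → SquareInfix (map (col c) p) → SquarePath D c
  squareInfix⇒SquarePath {D} {c} {p} path (a , u , b , u≢[] , eq)
    with pa , pub , refl , _  , eq₁ ← map-++⁻ (col c) p a ((u ++ u) ++ b) eq
    with pu , pb  , refl , eq₂ , _ ← map-++⁻ (col c) pub (u ++ u) b eq₁
    with h  , t   , refl , h↦u , t↦u ← map-++⁻ (col c) pu u u eq₂ =
    h , t , (λ { refl → u≢[] (sym h↦u) }) ,
    trans (sym (length-map (col c) h)) (trans (cong length (trans h↦u (sym t↦u))) (length-map (col c) t)) ,
    Path-infix pa (h ++ t) pb path , trans h↦u (sym t↦u)

  nonRepetitiveOn⊎squarePath : ∀ D c → NonRepetitiveOn D c ⊎ SquarePath D c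
  nonRepetitiveOn⊎squarePath D c with checkAll (listsUpTo elements (length elements))
    where
    checkAll : ∀ ps → (∀ {p} → p ∈ ps → Path D p → NonRepetitive (map (col c) p)) ⊎ SquarePath D c
    checkAll []       = inj₁ λ ()
    checkAll (p ∷ ps) with checkAll ps | Path? D p
    ... | inj₂ sq    | _         = inj₂ sq
    ... | inj₁ rest  | no ¬path  = inj₁ λ { (here refl) path → ⊥-elim (¬path path) ; (there p∈) → rest p∈ }
    ... | inj₁ rest  | yes path with nonRepetitive⊎squareInfix (≡-decᴹ _≟_) (map (col c) p)
    ...   | inj₂ sq  = inj₂ (squareInfix⇒SquarePath path sq)
    ...   | inj₁ nr  = inj₁ λ { (here refl) _ → nr ; (there p∈) → rest p∈ }
  ... | inj₂ sq      = inj₂ sq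
  ... | inj₁ allGood = inj₁ λ p path → allGood (∈-listsUpTo ∈-elements _ p (Unique⇒length≤ (proj₁ (proj₂ path)))) path

  nonRepetitiveOn? : ∀ D c → Dec (NonRepetitiveOn D c)
  nonRepetitiveOn? D c with nonRepetitiveOn⊎squarePath D c
  ... | inj₁ nonRep = yes nonRep
  ... | inj₂ sq     = no (SquarePath⇒¬NonRepetitiveOn sq)

  colourings : List (Elem G) → List (Coloring G)
  colourings D = filter (nonRepetitiveOn? D) (admissibleColourings D)

  ∈-colourings⁺ : ∀ {D c} → Valid D c → c ∈ colourings D
  ∈-colourings⁺ {D} (adm , nonRep) = ∈-filter⁺ (nonRepetitiveOn? D) (∈-admissibleColourings⁺ adm) nonRep

  ∈-colourings⁻ : ∀ {D c} → c ∈ colourings D → Valid D c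
  ∈-colourings⁻ {D} c∈ with c∈′ , nonRep ← ∈-filter⁻ (nonRepetitiveOn? D) {xs = admissibleColourings D} c∈ =
    ∈-admissibleColourings⁻ c∈′ , nonRep

  colourings-unique : ∀ D → Unique (colourings D)
  colourings-unique D = Unique.filter⁺ (nonRepetitiveOn? D) (admissibleColourings-unique D)

  count : List (Elem G) → ℕ
  count D = length (colourings D)

  Valid-resp : ∀ {D₁ D₂} → (∀ {y} → y ∈ D₁ → y ∈ D₂) → (∀ {y} → y ∈ D₂ → y ∈ D₁) → ∀ {c} → Valid D₁ c → Valid D₂ c
  Valid-resp to from (adm , nonRep) = (λ y → Admissible-resp to from (adm y)) ,
                                      (λ p (l , u , p∉) → nonRep p (l , u , All.map (_∘ to) p∉))

  count-cong : ∀ {D₁ D₂} → (∀ {y} → y ∈ D₁ → y ∈ D₂) → (∀ {y} → y ∈ D₂ → y ∈ D₁) → count D₁ ≡ count D₂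
  count-cong {D₁} {D₂} to from = Unique-⇔⇒length≡ (colourings-unique D₁) (colourings-unique D₂)
    (∈-colourings⁺ ∘ Valid-resp to from ∘ ∈-colourings⁻) (∈-colourings⁺ ∘ Valid-resp from to ∘ ∈-colourings⁻)

  module _ (S : Elem G → Set) (D : List (Elem G)) (to : ∀ {y} → S y → y ∈ D) (from : ∀ {y} → y ∈ D → S y) where

    InCL⇒Valid : ∀ {c} → InCL G L S c → Valid D c
    InCL⇒Valid (deleted , kept , nonRep) = admissible , λ p (l , u , p∉) → nonRep p (l , u , All.map (_∘ to) p∉)
      where
      admissible : ∀ y → Admissible D y (colAt G _ y)
      admissible y with y ∈? D
      ... | yes y∈ = inj₁ (y∈ , deleted y (from y∈))
      ... | no y∉  = inj₂ (y∉ , kept y (y∉ ∘ to))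

    Valid⇒InCL : ∀ {c} → Valid D c → InCL G L S c
    Valid⇒InCL (adm , nonRep) = (λ y s → Admissible-∈ (adm y) (to s)) , (λ y ¬s → Admissible-∉ (adm y) (¬s ∘ from)) ,
                                λ p (l , u , p∉) → nonRep p (l , u , All.map (_∘ from) p∉)

    count-HasSize : ∀ {k} → HasSize (InCL G L S) k → count D ≡ k
    count-HasSize (cs , cs-unique , cs⇔ , refl) = Unique-⇔⇒length≡ (colourings-unique D) cs-unique
      (λ c∈ → Equivalence.from (cs⇔ _) (Valid⇒InCL (∈-colourings⁻ c∈)))
      (λ c∈ → ∈-colourings⁺ (InCL⇒Valid (Equivalence.to (cs⇔ _) c∈)))

module DeletionStep (G : Graph) (L : Elem G → List ℕ) (L-unique : ∀ y → Unique (L y))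
                    (d : ℕ) (deg : ∀ v → degree G v < suc (suc d))
                    (D : List (Elem G)) (x : Elem G) (x∉D : x ∉ D) where

  open Incidence G
  open Colourings G L L-unique
  open WalkBound d using (Δ)
  open WalkCounting d deg
  open import Data.List.Membership.DecPropositional _≟ₑ_ using (_∈?_)

  β : ℕ
  β = 3 * Δ

  extend : Coloring G → ℕ → Coloring G
  extend c γ = paint c (x ∷ []) (just γ)

  erase : Coloring G → List (Elem G) → Coloring G
  erase e h = paint e h nothing

  col-extend-≢ : ∀ c γ z → z ≢ x → col (extend c γ) z ≡ col c z
  col-extend-≢ c γ z z≢x = col-paint-∉ c (x ∷ []) (just γ) {z} λ { (here refl) → z≢x refl }

  module _ {c} (c∈ : c ∈ colourings (x ∷ D)) (γ : ℕ) where

    private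
      admissible : ∀ z → Admissible (x ∷ D) z (col c z)
      admissible = proj₁ (∈-colourings⁻ c∈)

    extend-valid : γ ∈ L x → NonRepetitiveOn D (extend c γ) → Valid D (extend c γ)
    extend-valid γ∈ nonRep = admissible′ , nonRep
      where
      admissible′ : ∀ z → Admissible D z (col (extend c γ) z)
      admissible′ z with z ≟ₑ x
      ... | yes refl = inj₂ (x∉D , γ , col-paint-∈ c (x ∷ []) (just γ) (here refl) , γ∈)
      ... | no z≢x rewrite col-extend-≢ c γ z z≢x = Admissible-resp from there (admissible z)
        where
        from : z ∈ x ∷ D → z ∈ D
        from (here z≡x) = ⊥-elim (z≢x z≡x)
        from (there z∈D) = z∈D

    -- Off x the extension agrees with c, which has no square avoiding x.
    square-through-x : ∀ {h t} → length h ≡ length t → Path D (h ++ t) →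
                       map (col (extend c γ)) h ≡ map (col (extend c γ)) t → h ≢ [] → x ∈ h ++ t
    square-through-x {h} {t} lh path h≈t h≢[] with x ∈? (h ++ t)
    ... | yes x∈ = x∈
    ... | no x∉ = ⊥-elim (SquarePath⇒¬NonRepetitiveOn (h , t , h≢[] , lh , path′ , h≈t′) (proj₂ (∈-colourings⁻ c∈)))
      where
      path′ : Path (x ∷ D) (h ++ t)
      path′ = proj₁ path , proj₁ (proj₂ path) ,
              All.tabulate λ {z} z∈ → λ { (here refl) → x∉ z∈ ; (there z∈D) → All.lookup (proj₂ (proj₂ path)) z∈ z∈D }
      unchanged : ∀ zs → (∀ {z} → z ∈ zs → z ∈ h ++ t) → map (col (extend c γ)) zs ≡ map (col c) zs
      unchanged zs zs⊆ = map-cong-local (All.tabulate λ {z} z∈ → col-extend-≢ c γ z λ { refl → x∉ (zs⊆ z∈) })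
      h≈t′ : map (col c) h ≡ map (col c) t
      h≈t′ = trans (sym (unchanged h ∈-++⁺ˡ)) (trans h≈t (unchanged t (∈-++⁺ʳ h)))

    erase-valid : ∀ {h} → x ∈ h → Valid (h ++ D) (erase (extend c γ) h)
    erase-valid {h} x∈h = admissible′ , nonRep
      where
      unchanged : ∀ {z} → z ∉ h → col (erase (extend c γ) h) z ≡ col c z
      unchanged {z} z∉h = trans (col-paint-∉ (extend c γ) h nothing z∉h) (col-extend-≢ c γ z λ { refl → z∉h x∈h })
      admissible′ : ∀ z → Admissible (h ++ D) z (col (erase (extend c γ) h) z)
      admissible′ z with z ∈? h
      ... | yes z∈h = inj₁ (∈-++⁺ˡ z∈h , col-paint-∈ (extend c γ) h nothing z∈h)
      ... | no z∉h rewrite unchanged z∉h = Admissible-resp to from (admissible z)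
        where
        to : z ∈ x ∷ D → z ∈ h ++ D
        to (here refl) = ⊥-elim (z∉h x∈h)
        to (there z∈D) = ∈-++⁺ʳ h z∈D
        from : z ∈ h ++ D → z ∈ x ∷ D
        from z∈ = [ ⊥-elim ∘ z∉h , there ]′ (∈-++⁻ h z∈)
      nonRep : NonRepetitiveOn (h ++ D) (erase (extend c γ) h)
      nonRep p (l , u , p∉) = subst NonRepetitive (sym (map-cong-local (All.tabulate (unchanged ∘ ∉h))))
                                (proj₂ (∈-colourings⁻ c∈) p (l , u , All.tabulate p∉x∷D))
        where
        ∉h : ∀ {z} → z ∈ p → z ∉ h
        ∉h z∈ = All.lookup p∉ z∈ ∘ ∈-++⁺ˡ
        p∉x∷D : ∀ {z} → z ∈ p → z ∉ x ∷ D
        p∉x∷D z∈ (here refl) = ∉h z∈ x∈h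
        p∉x∷D z∈ (there z∈D) = All.lookup p∉ z∈ (∈-++⁺ʳ h z∈D)

  GoodPath : ℕ → List (Elem G) → Set
  GoodPath k q = length q ≡ suc k + suc k × x ∈ take (suc k) q × Path D q

  goodPath? : ∀ k q → Dec (GoodPath k q)
  goodPath? k q = (length q ≟ suc k + suc k) ×-dec ((x ∈? take (suc k) q) ×-dec Path? D q)

  OrientedSquare : Coloring G → List (Elem G) → List (Elem G) → Set
  OrientedSquare e h t = x ∈ h × length h ≡ length t × Path D (h ++ t) × map (col e) h ≡ map (col e) t

  orient : List (Elem G) → List (Elem G) → List (Elem G) × List (Elem G)
  orient h t with x ∈? h
  ... | yes _ = h , t
  ... | no _  = reverse t , reverse h

  orient-square : ∀ {e h t} → x ∈ h ++ t → length h ≡ length t → Path D (h ++ t) → map (col e) h ≡ map (col e) t →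
                  OrientedSquare e (proj₁ (orient h t)) (proj₂ (orient h t))
  orient-square {e} {h} {t} x∈ lh path h≈t with x ∈? h
  ... | yes x∈h = x∈h , lh , path , h≈t
  ... | no x∉h  = AnyP.reverse⁺ ([ ⊥-elim ∘ x∉h , (λ x∈t → x∈t) ]′ (∈-++⁻ h x∈)) ,
                  trans (length-reverse t) (trans (sym lh) (sym (length-reverse h))) ,
                  subst (Path D) (reverse-++ h t) (Path-reverse path) ,
                  trans (reverse-map (col e) t) (trans (cong reverse (sym h≈t)) (sym (reverse-map (col e) h)))

  goodPaths : ℕ → List (List (Elem G))
  goodPaths k = filter (goodPath? k) (pathsThrough x k)

  length-goodPaths≤ : ∀ k → length (goodPaths k) ≤ suc k * Δ ^ suc k
  length-goodPaths≤ k = ≤-trans (length-filter (goodPath? k) (pathsThrough x k)) (length-pathsThrough≤ x k)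

  encodingsOfLength : ℕ → List (List (Elem G) × Coloring G)
  encodingsOfLength k = concatMap (λ q → map (q ,_) (colourings (take (suc k) q ++ D))) (goodPaths k)

  encodings : List (List (Elem G) × Coloring G)
  encodings = concatMap encodingsOfLength (downFrom (length elements))

  ∈-encodings : ∀ {c} → c ∈ colourings (x ∷ D) → ∀ γ {h t} → OrientedSquare (extend c γ) h t →
                (h ++ t , erase (extend c γ) h) ∈ encodings
  ∈-encodings {c} c∈ γ {h₀@(z ∷ h)} {t} (x∈h , lh , path , _) =
    ∈-concatMap⁺ encodingsOfLength (Any.map (λ { refl → ofLength }) (∈-downFrom⁺ k<K))
    where
    k = length h
    lq : length (h₀ ++ t) ≡ suc k + suc k
    lq = trans (length-++ h₀) (cong (suc k +_) (sym lh))
    k<K : k < length elements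
    k<K = ≤-trans (m≤m+n (suc k) (suc k)) (subst (_≤ length elements) lq (Unique⇒length≤ (proj₁ (proj₂ path))))
    x∈take : x ∈ take (suc k) (h₀ ++ t)
    x∈take = subst (x ∈_) (sym (take-length-++ h₀ t)) x∈h
    ofLength : (h₀ ++ t , erase (extend c γ) h₀) ∈ encodingsOfLength k
    ofLength = ∈-concatMap⁺ (λ q → map (q ,_) (colourings (take (suc k) q ++ D)))
      (Any.map (λ { refl → ∈-map⁺ (h₀ ++ t ,_) erased∈ }) good)
      where
      erased∈ : erase (extend c γ) h₀ ∈ colourings (take (suc k) (h₀ ++ t) ++ D)
      erased∈ = subst (λ p → erase (extend c γ) h₀ ∈ colourings (p ++ D)) (sym (take-length-++ h₀ t))
                      (∈-colourings⁺ (erase-valid c∈ γ x∈h))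
      good : h₀ ++ t ∈ goodPaths k
      good = ∈-filter⁺ (goodPath? k) (∈-pathsThrough x k (h₀ ++ t) lq x∈take (proj₁ path) (proj₁ (proj₂ path)))
                       (lq , x∈take , path)

  OrientedSquare-halves : ∀ {e₁ e₂ h₁ t₁ h₂ t₂} → OrientedSquare e₁ h₁ t₁ → OrientedSquare e₂ h₂ t₂ →
                          h₁ ++ t₁ ≡ h₂ ++ t₂ → h₁ ≡ h₂ × t₁ ≡ t₂
  OrientedSquare-halves {h₁ = h₁} {t₁} {h₂} {t₂} (_ , lh₁ , _) (_ , lh₂ , _) q≡ =
    ++-cancel-length h₁ t₁ h₂ t₂ q≡ (double-injective (length h₁) (length h₂) (begin
      length h₁ + length h₁ ≡⟨ cong (length h₁ +_) lh₁ ⟩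
      length h₁ + length t₁ ≡⟨ length-++ h₁ ⟨
      length (h₁ ++ t₁)     ≡⟨ cong length q≡ ⟩
      length (h₂ ++ t₂)     ≡⟨ length-++ h₂ ⟩
      length h₂ + length t₂ ≡⟨ cong (length h₂ +_) lh₂ ⟨
      length h₂ + length h₂ ∎))
    where open ≡-Reasoning

  -- The colours erased on h are recovered from the disjoint copy t.
  erase-injective : ∀ {e₁ e₂ h t} → OrientedSquare e₁ h t → OrientedSquare e₂ h t → erase e₁ h ≡ erase e₂ h → e₁ ≡ e₂
  erase-injective {e₁} {e₂} {h} {t} (_ , _ , path , h≈t₁) (_ , _ , _ , h≈t₂) erased≡ = col-injective λ z → agree z
    where
    outside : ∀ {z} → z ∉ h → col e₁ z ≡ col e₂ z
    outside {z} z∉ = trans (sym (col-paint-∉ e₁ h nothing z∉))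
                           (trans (cong (λ e → col e z) erased≡) (col-paint-∉ e₂ h nothing z∉))
    agree : ∀ z → col e₁ z ≡ col e₂ z
    agree z with z ∈? h
    ... | no z∉  = outside z∉
    ... | yes z∈ = agree-on-copy (col e₁) (col e₂) h≈t₁ h≈t₂
                     (λ w∈t → outside (λ w∈h → Unique-++⇒disjoint h (proj₁ (proj₂ path)) w∈h w∈t)) z∈

  extend-injective : ∀ {c₁ c₂ γ₁ γ₂} → c₁ ∈ colourings (x ∷ D) → c₂ ∈ colourings (x ∷ D) →
                     extend c₁ γ₁ ≡ extend c₂ γ₂ → (c₁ , γ₁) ≡ (c₂ , γ₂)
  extend-injective {c₁} {c₂} {γ₁} {γ₂} c₁∈ c₂∈ eq = cong₂ _,_ (col-injective agree) (just-injective (begin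
    just γ₁             ≡⟨ col-paint-∈ c₁ (x ∷ []) (just γ₁) (here refl) ⟨
    col (extend c₁ γ₁) x ≡⟨ cong (λ e → col e x) eq ⟩
    col (extend c₂ γ₂) x ≡⟨ col-paint-∈ c₂ (x ∷ []) (just γ₂) (here refl) ⟩
    just γ₂             ∎))
    where
    open ≡-Reasoning
    uncoloured : ∀ {c} → c ∈ colourings (x ∷ D) → col c x ≡ nothing
    uncoloured c∈ = Admissible-∈ (proj₁ (∈-colourings⁻ c∈) x) (here refl)
    agree : ∀ z → col c₁ z ≡ col c₂ z
    agree z with z ≟ₑ x
    ... | yes refl = trans (uncoloured c₁∈) (sym (uncoloured c₂∈))
    ... | no z≢x   = trans (sym (col-extend-≢ c₁ γ₁ z z≢x))
                           (trans (cong (λ e → col e z) eq) (col-extend-≢ c₂ γ₂ z z≢x))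

  Code : Set
  Code = Coloring G ⊎ (List (Elem G) × Coloring G)

  encodeWith : ∀ e → NonRepetitiveOn D e ⊎ SquarePath D e → Code
  encodeWith e (inj₁ _)           = inj₁ e
  encodeWith e (inj₂ (h , t , _)) = inj₂ (proj₁ (orient h t) ++ proj₂ (orient h t) , erase e (proj₁ (orient h t)))

  -- A non-repetitive extension is its own code; otherwise the code is an oriented square together with the
  -- extension with the square's first half erased.
  encode : Coloring G × ℕ → Code
  encode (c , γ) = encodeWith (extend c γ) (nonRepetitiveOn⊎squarePath D (extend c γ))

  extensions : List (Coloring G × ℕ)
  extensions = cartesianProduct (colourings (x ∷ D)) (L x)

  codes : List Code
  codes = map inj₁ (colourings D) ++ map inj₂ encodings

  encode-∈ : ∀ {p} → p ∈ extensions → encode p ∈ codes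
  encode-∈ {c , γ} p∈ with c∈ , γ∈ ← ∈-cartesianProduct⁻ (colourings (x ∷ D)) (L x) p∈
    with nonRepetitiveOn⊎squarePath D (extend c γ)
  ... | inj₁ nonRep = ∈-++⁺ˡ (∈-map⁺ inj₁ (∈-colourings⁺ (extend-valid c∈ γ γ∈ nonRep)))
  ... | inj₂ (h , t , h≢[] , lh , path , h≈t) = ∈-++⁺ʳ (map inj₁ (colourings D)) (∈-map⁺ inj₂
        (∈-encodings c∈ γ (orient-square (square-through-x c∈ γ lh path h≈t h≢[]) lh path h≈t)))

  encode-injective : ∀ {p₁ p₂} → p₁ ∈ extensions → p₂ ∈ extensions → encode p₁ ≡ encode p₂ → p₁ ≡ p₂
  encode-injective {c₁ , γ₁} {c₂ , γ₂} p₁∈ p₂∈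
    with c₁∈ , _ ← ∈-cartesianProduct⁻ (colourings (x ∷ D)) (L x) p₁∈
       | c₂∈ , _ ← ∈-cartesianProduct⁻ (colourings (x ∷ D)) (L x) p₂∈
    with nonRepetitiveOn⊎squarePath D (extend c₁ γ₁) | nonRepetitiveOn⊎squarePath D (extend c₂ γ₂)
  ... | inj₁ _ | inj₁ _ = extend-injective c₁∈ c₂∈ ∘ inj₁-injective
  ... | inj₁ _ | inj₂ _ = λ ()
  ... | inj₂ _ | inj₁ _ = λ ()
  ... | inj₂ (h₁ , t₁ , h₁≢[] , lh₁ , path₁ , h≈t₁) | inj₂ (h₂ , t₂ , h₂≢[] , lh₂ , path₂ , h≈t₂) = λ eq →
    let sq₁ = orient-square (square-through-x c₁∈ γ₁ lh₁ path₁ h≈t₁ h₁≢[]) lh₁ path₁ h≈t₁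
        sq₂ = orient-square (square-through-x c₂∈ γ₂ lh₂ path₂ h≈t₂ h₂≢[]) lh₂ path₂ h≈t₂
        q≡ , erased≡ = ,-injective (inj₂-injective eq)
    in extend-injective c₁∈ c₂∈ (sameHalves sq₁ sq₂ (OrientedSquare-halves sq₁ sq₂ q≡) erased≡)
    where
    sameHalves : ∀ {e₁ e₂ h₁ t₁ h₂ t₂} → OrientedSquare e₁ h₁ t₁ → OrientedSquare e₂ h₂ t₂ → h₁ ≡ h₂ × t₁ ≡ t₂ →
                 erase e₁ h₁ ≡ erase e₂ h₂ → e₁ ≡ e₂
    sameHalves sq₁ sq₂ (refl , refl) = erase-injective sq₁ sq₂

  extensions≤codes : length (L x) * count (x ∷ D) ≤ count D + length encodings
  extensions≤codes = begin
    length (L x) * count (x ∷ D)  ≡⟨ *-comm (length (L x)) _ ⟩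
    count (x ∷ D) * length (L x)  ≡⟨ length-cartesianProduct (colourings (x ∷ D)) (L x) ⟨
    length extensions             ≤⟨ injection⇒length≤ encode extensions-unique encode-injective encode-∈ ⟩
    length codes                  ≡⟨ length-++ (map inj₁ (colourings D)) ⟩
    length (map inj₁ (colourings D)) + length (map inj₂ encodings)
                                  ≡⟨ cong₂ _+_ (length-map inj₁ (colourings D)) (length-map inj₂ encodings) ⟩
    count D + length encodings    ∎
    where
    open ≤-Reasoning
    extensions-unique = Unique.cartesianProduct⁺ (colourings-unique (x ∷ D)) (L-unique x)

  module _ (IH : ∀ T y → (∀ {z} → z ∈ x ∷ D → z ∈ T) → y ∉ T → β * count (y ∷ T) ≤ count T) where

    deleting-chain≤ : ∀ h → Unique h → All (_∉ x ∷ D) h → β ^ length h * count (h ++ x ∷ D) ≤ count (x ∷ D)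
    deleting-chain≤ []      _        _          = ≤-reflexive (+-identityʳ _)
    deleting-chain≤ (z ∷ h) (z∉h ∷ u) (z∉ ∷ h∉) = begin
      β * β ^ length h * count (z ∷ h ++ x ∷ D)   ≡⟨ solve β (β ^ length h) _ ⟩
      β ^ length h * (β * count (z ∷ h ++ x ∷ D)) ≤⟨ *-monoʳ-≤ (β ^ length h) (IH (h ++ x ∷ D) z (∈-++⁺ʳ h) z∉T) ⟩
      β ^ length h * count (h ++ x ∷ D)           ≤⟨ deleting-chain≤ h u h∉ ⟩
      count (x ∷ D)                               ∎
      where
      open ≤-Reasoning
      solve : ∀ p q r → p * q * r ≡ q * (p * r)
      solve = solve-∀
      z∉T : z ∉ h ++ x ∷ D
      z∉T z∈ = [ (λ z∈h → All.lookup z∉h z∈h refl) , z∉ ]′ (∈-++⁻ h z∈)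

    -- Deleting the first half of a good path amounts to deleting x and k further elements.
    count-firstHalf≤ : ∀ k q → GoodPath k q → β ^ k * count (take (suc k) q ++ D) ≤ count (x ∷ D)
    count-firstHalf≤ k q (lq , x∈h , (_ , u , q∉)) =
      subst (λ n → β ^ n * count (h ++ D) ≤ count (x ∷ D)) length-h⁻
        (subst (λ n → β ^ length h⁻ * n ≤ count (x ∷ D)) (sym (count-cong to from))
          (deleting-chain≤ h⁻ (Unique.filter⁺ (λ z → ¬? (z ≟ₑ x)) (Unique.take⁺ (suc k) u)) h⁻∉))
      where
      h = take (suc k) q
      h⁻ = filter (λ z → ¬? (z ≟ₑ x)) h
      ∈-h⁻ : ∀ {z} → z ∈ h⁻ → z ∈ h × z ≢ x
      ∈-h⁻ = ∈-filter⁻ (λ z → ¬? (z ≟ₑ x)) {xs = h}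
      h⁻∉ : All (_∉ x ∷ D) h⁻
      h⁻∉ = All.tabulate λ z∈ → λ { (here refl) → proj₂ (∈-h⁻ z∈) refl
                                   ; (there z∈D) → All.lookup (All.take⁺ (suc k) q∉) (proj₁ (∈-h⁻ z∈)) z∈D }
      length-h⁻ : length h⁻ ≡ k
      length-h⁻ = suc-injective (begin
        suc (length h⁻)          ≡⟨ length-filter-≢ _≟ₑ_ (Unique.take⁺ (suc k) u) x∈h ⟩
        length h                 ≡⟨ length-take (suc k) q ⟩
        suc k ⊓ length q         ≡⟨ m≤n⇒m⊓n≡m (subst (suc k ≤_) (sym lq) (m≤m+n (suc k) (suc k))) ⟩
        suc k                    ∎)
        where open ≡-Reasoning
      to : ∀ {z} → z ∈ h ++ D → z ∈ h⁻ ++ x ∷ D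
      to {z} z∈ with ∈-++⁻ h z∈ | z ≟ₑ x
      ... | inj₂ z∈D | _      = ∈-++⁺ʳ h⁻ (there z∈D)
      ... | inj₁ _   | yes refl = ∈-++⁺ʳ h⁻ (here refl)
      ... | inj₁ z∈h | no z≢x = ∈-++⁺ˡ (∈-filter⁺ (λ z → ¬? (z ≟ₑ x)) z∈h z≢x)
      from : ∀ {z} → z ∈ h⁻ ++ x ∷ D → z ∈ h ++ D
      from z∈ with ∈-++⁻ h⁻ z∈
      ... | inj₁ z∈h⁻        = ∈-++⁺ˡ (proj₁ (∈-h⁻ z∈h⁻))
      ... | inj₂ (here refl) = ∈-++⁺ˡ x∈h
      ... | inj₂ (there z∈D) = ∈-++⁺ʳ h z∈D

    length-encodingsOfLength≤ : ∀ k → 3 ^ k * length (encodingsOfLength k) ≤ suc k * (Δ * count (x ∷ D))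
    length-encodingsOfLength≤ k = *-cancelˡ-≤ (Δ ^ k) {{m^n≢0 Δ k}} (begin
      Δ ^ k * (3 ^ k * length (encodingsOfLength k)) ≡⟨ solve1 (Δ ^ k) (3 ^ k) (length (encodingsOfLength k)) ⟩
      3 ^ k * Δ ^ k * length (encodingsOfLength k)   ≡⟨ cong (_* length (encodingsOfLength k)) (^-distribʳ-* 3 Δ k) ⟨
      β ^ k * length (encodingsOfLength k)           ≤⟨ *-length-concatMap≤ _ (goodPaths k) (β ^ k) b perPath ⟩
      length (goodPaths k) * b                       ≤⟨ *-monoˡ-≤ b (length-goodPaths≤ k) ⟩
      suc k * (Δ * Δ ^ k) * b                        ≡⟨ solve2 (suc k) Δ (Δ ^ k) b ⟩
      Δ ^ k * (suc k * (Δ * b))                      ∎)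
      where
      open ≤-Reasoning
      b = count (x ∷ D)
      solve1 : ∀ a c v → a * (c * v) ≡ c * a * v
      solve1 = solve-∀
      solve2 : ∀ s D X b → s * (D * X) * b ≡ X * (s * (D * b))
      solve2 = solve-∀
      perPath : ∀ {q} → q ∈ goodPaths k → β ^ k * length (map (q ,_) (colourings (take (suc k) q ++ D))) ≤ b
      perPath {q} q∈ = subst (λ n → β ^ k * n ≤ b) (sym (length-map (q ,_) (colourings (take (suc k) q ++ D))))
                             (count-firstHalf≤ k q (proj₂ (∈-filter⁻ (goodPath? k) {xs = pathsThrough x k} q∈)))

    length-encodings≤ : length encodings ≤ 3 * (Δ * count (x ∷ D))
    length-encodings≤ = subst (_≤ 3 * (Δ * count (x ∷ D)))
      (sym (length-concatMap encodingsOfLength (downFrom (length elements))))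
      (sum≤3*bound (length ∘ encodingsOfLength) _ (length elements) (λ {k} _ → length-encodingsOfLength≤ k))

    extensions≤ : length (L x) * count (x ∷ D) ≤ count D + 3 * (Δ * count (x ∷ D))
    extensions≤ = ≤-trans extensions≤codes (+-monoʳ-≤ (count D) length-encodings≤)

module DeletionInduction (G : Graph) (L : Elem G → List ℕ) (L-unique : ∀ y → Unique (L y))
                         (d : ℕ) (deg : ∀ v → degree G v < suc (suc d)) (L-large : ∀ y → 6 * suc (suc d) ≤ length (L y)) where

  open Incidence G
  open Colourings G L L-unique
  open WalkBound d using (Δ)

  remaining : List (Elem G) → ℕ
  remaining D = length (filter (_∉? D) elements)

  count-deleting≤ : ∀ N D x → remaining D ≤ N → x ∉ D → 3 * Δ * count (x ∷ D) ≤ count D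
  count-deleting≤ zero    D x D≤0 x∉D = ⊥-elim (<⇒≱ (∈-length (∈-filter⁺ (_∉? D) (∈-elements x) x∉D)) D≤0)
  count-deleting≤ (suc N) D x D≤N x∉D = +-cancelʳ-≤ (3 * (Δ * b)) (3 * Δ * b) (count D) (begin
      3 * Δ * b + 3 * (Δ * b) ≡⟨ solve Δ b ⟩
      6 * Δ * b               ≤⟨ *-monoˡ-≤ b (L-large x) ⟩
      length (L x) * b        ≤⟨ extensions≤ IH ⟩
      count D + 3 * (Δ * b)   ∎)
    where
    open ≤-Reasoning
    open DeletionStep G L L-unique d deg D x x∉D
    b = count (x ∷ D)
    solve : ∀ Δ b → 3 * Δ * b + 3 * (Δ * b) ≡ 6 * Δ * b
    solve = solve-∀
    IH : ∀ T y → (∀ {z} → z ∈ x ∷ D → z ∈ T) → y ∉ T → 3 * Δ * count (y ∷ T) ≤ count T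
    IH T y x∷D⊆T y∉T = count-deleting≤ N T y (≤-pred (<-≤-trans (≤-<-trans T≤x∷D x∷D<D) D≤N)) y∉T
      where
      T≤x∷D : remaining T ≤ remaining (x ∷ D)
      T≤x∷D = length-filter-mono (_∉? T) (_∉? (x ∷ D)) (λ z∉T z∈ → z∉T (x∷D⊆T z∈)) elements
      x∷D<D : remaining (x ∷ D) < remaining D
      x∷D<D = length-filter-strict (_∉? (x ∷ D)) (_∉? D) (λ z∉ z∈D → z∉ (there z∈D))
                                   (∈-elements x) x∉D (λ x∉ → x∉ (here refl))

lemma3 : (Δ : ℕ) → 2 ≤ Δ → (G : Graph) → (∀ v → degree G v < Δ) →
         (L : Elem G → List ℕ) →
         (∀ y → Unique (L y) × (6 * Δ ≤ length (L y))) →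
         (x : Elem G) → (a b : ℕ) →
         HasSize (InCL G L (NoElems G)) a →
         HasSize (InCL G L (λ y → y ≡ x)) b →
         3 * Δ * b ≤ a
lemma3 (suc (suc d)) (s≤s (s≤s z≤n)) G deg L L-ok x a b size-a size-b =
  subst₂ (λ b a → 3 * suc (suc d) * b ≤ a) count≡b count≡a (count-deleting≤ (remaining []) [] x ≤-refl λ ())
  where
  open DeletionInduction G L (proj₁ ∘ L-ok) d deg (proj₂ ∘ L-ok)
  open Colourings G L (proj₁ ∘ L-ok)
  count≡a : count [] ≡ a
  count≡a = count-HasSize (NoElems G) [] (λ ()) (λ ()) size-a
  count≡b : count (x ∷ []) ≡ b
  count≡b = count-HasSize (_≡ x) (x ∷ []) (λ { refl → here refl }) (λ { (here refl) → refl }) size-b
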